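{- Let $\Sigma$ be a rule set and $\mathcal{D}$ a database. For every normal Boolean conjunctive query $q$ such that (a) $\Sigma,\mathcal{D}\models \exists\vec x.\,\bigwedge q^+$ and (b) $\Sigma,\mathcal{D}\not\models\exists\vec x.\,(\bigwedge q^+\wedge a(\vec t))$ for every $a(\vec t)\in q^-$, there is a universal model $\mathcal{U}$ of $\Sigma$ and $\mathcal{D}$ with $\mathcal{U}\models q$.
   Context: Fix pairwise disjoint sets of constants, nulls, variables and predicates with arities. An interpretation is a set of variable-free atoms; a database is a finite set of ground (constant-only) atoms. An existential rule is $\forall\vec x,\vec y.\,\varphi[\vec x,\vec y]\to\exists\vec z.\,\psi[\vec y,\vec z]$ (body/head conjunctions of atoms, frontier $\vec y$ occurring in the body); a rule set is a finite set of rules. Homomorphisms fix constants and preserve atoms. A model of $\Sigma$ and $\mathcal{D}$ is an interpretation containing $\mathcal{D}$ in which every homomorphism from a rule body extends to one of the rule head; a model is universal if it maps homomorphically into every model of $\Sigma$ and $\mathcal{D}$. A normal Boolean conjunctive query is $q=\exists\vec x.\,\varphi\wedge\psi$ with $\varphi$ a conjunction of atoms (set $q^+$) over $\vec x$ and constants and $\psi$ a conjunction of negated atoms (the set $q^-$ of the un-negated atoms) whose variables occur in $\varphi$, with $q^+\cap q^-=\emptyset$. $I\models q$ if some homomorphism $h:q^+\to I$ has $h(q^-)\cap I=\emptyset$. For a Boolean conjunctive query (no negation) $Q$, $\Sigma,\mathcal{D}\models Q$ means every model of $\Sigma$ and $\mathcal{D}$ satisfies $Q$. -}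

module Defs where

open import Level using (Level)
open import Data.Nat using (ℕ)
open import Data.Vec using (Vec)
import Data.Vec as Vec
open import Data.Vec.Membership.Propositional renaming (_∈_ to _∈ᵥ_)
open import Data.List using (List)
open import Data.List.Membership.Propositional using (_∈_)
open import Data.List.Relation.Unary.All using (All)
open import Data.List.Relation.Unary.Any using (Any)
open import Data.Product using (Σ; Σ-syntax; _×_)
open import Data.Empty using (⊥)
open import Relation.Nullary using (¬_)
open import Relation.Binary.PropositionalEquality using (_≡_)

-- Constants and nulls (labelled nulls) are both ℕ, kept disjoint by tagging.
-- Variable-free terms (used in interpretations):
data GTerm : Set where
  gcon  : ℕ → GTerm
  gnull : ℕ → GTerm

data Term : Set where
  tvar : ℕ → Term
  tcon : ℕ → Term

module Sig (ar : ℕ → ℕ) where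

  record Atom (T : Set) : Set where
    constructor atom
    field
      pred : ℕ
      args : Vec T (ar pred)
  open Atom public

  mapAtom : {T U : Set} → (T → U) → Atom T → Atom U
  mapAtom f (atom p ts) = atom p (Vec.map f ts)

  Interp : Set₁
  Interp = Atom GTerm → Set

  Database : Set
  Database = List (Atom ℕ)

  Assignment : Set
  Assignment = ℕ → GTerm

  inst : Assignment → Term → GTerm
  inst s (tvar x) = s x
  inst s (tcon c) = gcon c

  _⟦_⟧ : Atom Term → Assignment → Atom GTerm
  a ⟦ s ⟧ = mapAtom (inst s) a

  Holds : Interp → Assignment → List (Atom Term) → Set
  Holds I s as = All (λ a → I (a ⟦ s ⟧)) as

  Occurs : ℕ → Atom Term → Set
  Occurs x a = tvar x ∈ᵥ args a

  -- Existential rule  body → ∃ z. head ; the frontier variables are the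
  -- head variables occurring in the body, the other head variables are
  -- existentially quantified.
  record Rule : Set where
    constructor rule
    field
      body : List (Atom Term)
      head : List (Atom Term)
  open Rule public

  Satisfies : Interp → Rule → Set
  Satisfies I r =
    (s : Assignment) → Holds I s (body r) →
    Σ[ s' ∈ Assignment ] ((∀ x → Any (Occurs x) (body r) → s' x ≡ s x)
                          × Holds I s' (head r))

  IsModel : List Rule → Database → Interp → Set
  IsModel Rs D I =
    (∀ a → a ∈ D → I (mapAtom gcon a)) × (∀ r → r ∈ Rs → Satisfies I r)

  Hom : Interp → Interp → Set
  Hom I J = Σ[ f ∈ (GTerm → GTerm) ]
              ((∀ c → f (gcon c) ≡ gcon c) × (∀ a → I a → J (mapAtom f a)))

  IsUniversalModel : List Rule → Database → Interp → Set₁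
  IsUniversalModel Rs D U =
    IsModel Rs D U × ((M : Interp) → IsModel Rs D M → Hom U M)

  Entails : List Rule → Database → List (Atom Term) → Set₁
  Entails Rs D Q = (M : Interp) → IsModel Rs D M → Σ[ s ∈ Assignment ] Holds M s Q

  record NBCQ : Set where
    field
      pos      : List (Atom Term)
      neg      : List (Atom Term)
      safe     : ∀ x → Any (Occurs x) neg → Any (Occurs x) pos
      disjoint : ∀ a → a ∈ pos → a ∈ neg → ⊥
  open NBCQ public

  _⊨_ : Interp → NBCQ → Set
  I ⊨ q = Σ[ s ∈ Assignment ] (Holds I s (pos q) × All (λ a → ¬ I (a ⟦ s ⟧)) (neg q))

{-# OPTIONS --safe #-}

-- The chase of Σ and 𝒟 is a universal model U. It is built in rounds, each firing every
-- active trigger with fresh nulls, and it maps into any model M round by round: the images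
-- of the nulls created by a trigger are chosen by M's satisfaction of the trigger's rule,
-- which is possible because the name of a null records the round and trigger creating it.
-- By (a), q⁺ holds in U under some σ. If a(σ) ∈ U for some a ∈ q⁻, composing σ with the
-- homomorphisms U → M makes q⁺ ∧ a hold in every model, contradicting (b).
module Submission where

open import Data.Empty using (⊥-elim)
open import Data.List using (List; []; _∷_; _++_; [_]; length; concat; concatMap; applyUpTo; cartesianProductWith)
import Data.List as List
open import Data.List.Membership.Propositional using (_∈_; mapWith∈; lose)
open import Data.List.Membership.Propositional.Properties
  using ( ∈-++⁺ˡ; ∈-++⁺ʳ; ∈-++⁻; ∈-map⁺; ∈-map⁻; ∈-concat⁺′; ∈-concat⁻′; ∈-applyUpTo⁺; ∈-applyUpTo⁻
        ; ∈-cartesianProductWith⁺)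
open import Data.List.Relation.Unary.All as All using (All; []; _∷_)
import Data.List.Relation.Unary.All.Properties as AllP
open import Data.List.Relation.Unary.Any using (Any; here; there)
open import Data.Maybe using (Maybe; just; nothing)
open import Data.Nat using (ℕ; zero; suc; _+_; _≤_; _<_; _⊔_; pred; z≤n; s≤s; _≟_; _≤′_; ≤′-refl; ≤′-step)
open import Data.Nat.Properties
  using (+-suc; +-identityʳ; ≤⇒≤′; m≤m⊔n; m≤n⊔m; m≤n⇒m≤1+n; ≤-reflexive; 1+n≰n; n≤0⇒n≡0; ≤-pred; ≤∧≢⇒<)
open import Data.List.Membership.DecPropositional _≟_ using () renaming (_∈?_ to _∈ℕ?_)
open import Data.Product using (Σ-syntax; _×_; _,_; proj₁; proj₂)
open import Data.Sum using (_⊎_; inj₁; inj₂)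
open import Data.Vec using (Vec; []; _∷_)
import Data.Vec as Vec
import Data.Vec.Properties as VecP
open import Data.Vec.Membership.Propositional using (find) renaming (_∈_ to _∈ᵥ_)
import Data.Vec.Membership.Propositional.Properties as VMP
open import Data.Vec.Relation.Unary.Any using (here; there)
import Data.Vec.Relation.Unary.Any.Properties as VAnyP
open import Function using (_∘_; id; const)
open import Relation.Binary using (DecidableEquality)
open import Relation.Binary.PropositionalEquality using (_≡_; refl; sym; trans; cong; cong₂; subst)
open import Relation.Nullary using (¬_; Dec; yes; no)
import Relation.Nullary.Decidable as Dec

open import Defs

unpairStep : ℕ × ℕ → ℕ × ℕ
unpairStep (a , zero) = 0 , suc a
unpairStep (a , suc b) = suc a , b

unpair : ℕ → ℕ × ℕ
unpair zero = 0 , 0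
unpair (suc n) = unpairStep (unpair n)

-- pairOn d a b is the index of (a , b) in the enumeration unpair, provided d ≡ a + b.
pairOn : ℕ → ℕ → ℕ → ℕ
pairOn d (suc a) b = suc (pairOn d a (suc b))
pairOn (suc d) zero (suc b) = suc (pairOn d b 0)
pairOn _ zero _ = 0

unpair-pairOn : ∀ d a b → d ≡ a + b → unpair (pairOn d a b) ≡ (a , b)
unpair-pairOn d (suc a) b d≡ rewrite unpair-pairOn d a (suc b) (trans d≡ (sym (+-suc a b))) = refl
unpair-pairOn (suc d) zero (suc b) d≡ rewrite unpair-pairOn d b 0 (trans (cong pred d≡) (sym (+-identityʳ b))) = refl
unpair-pairOn zero zero zero _ = refl

pair : ℕ → ℕ → ℕ
pair a b = pairOn (a + b) a b

unpair-pair : ∀ a b → unpair (pair a b) ≡ (a , b)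
unpair-pair a b = unpair-pairOn (a + b) a b refl

module _ {A : Set} where

  _!?_ : List A → ℕ → Maybe A
  [] !? _ = nothing
  (x ∷ xs) !? zero = just x
  (x ∷ xs) !? suc j = xs !? j

  ∈⇒!? : ∀ {x xs} → x ∈ xs → Σ[ j ∈ ℕ ] (j < length xs × xs !? j ≡ just x)
  ∈⇒!? (here refl) = 0 , s≤s z≤n , refl
  ∈⇒!? (there x∈xs) with j , j< , eq ← ∈⇒!? x∈xs = suc j , s≤s j< , eq

  ∈-mapWith∈⁺ : ∀ {B : Set} {xs : List A} (f : ∀ {x} → x ∈ xs → B) {x} (x∈xs : x ∈ xs) →
    f x∈xs ∈ mapWith∈ xs f
  ∈-mapWith∈⁺ f (here refl) = here refl
  ∈-mapWith∈⁺ f (there x∈xs) = there (∈-mapWith∈⁺ (λ x∈ → f (there x∈)) x∈xs)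

  map-cong-∈ : ∀ {B : Set} {n} {f g : A → B} (xs : Vec A n) → (∀ {x} → x ∈ᵥ xs → f x ≡ g x) →
    Vec.map f xs ≡ Vec.map g xs
  map-cong-∈ [] f≗g = refl
  map-cong-∈ (x ∷ xs) f≗g = cong₂ _∷_ (f≗g (here refl)) (map-cong-∈ xs (f≗g ∘ there))

  ∈-map⁻ᵥ : ∀ {B : Set} {n} {f : A → B} {xs : Vec A n} {y} → y ∈ᵥ Vec.map f xs →
    Σ[ x ∈ A ] (x ∈ᵥ xs × y ≡ f x)
  ∈-map⁻ᵥ y∈ = find (VAnyP.map⁻ y∈)

gcon-injective : ∀ {a b} → gcon a ≡ gcon b → a ≡ b
gcon-injective refl = refl

gnull-injective : ∀ {a b} → gnull a ≡ gnull b → a ≡ b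
gnull-injective refl = refl

_≟ᴳ_ : DecidableEquality GTerm
gcon a ≟ᴳ gcon b = Dec.map′ (cong gcon) gcon-injective (a ≟ b)
gnull a ≟ᴳ gnull b = Dec.map′ (cong gnull) gnull-injective (a ≟ b)
gcon _ ≟ᴳ gnull _ = no λ ()
gnull _ ≟ᴳ gcon _ = no λ ()

module _ {ar : ℕ → ℕ} where
  open Sig ar

  _≟ᴬ_ : DecidableEquality (Atom GTerm)
  atom p xs ≟ᴬ atom q ys with p ≟ q
  ... | no p≢q = no λ { refl → p≢q refl }
  ... | yes refl = Dec.map′ (cong (atom p)) (λ { refl → refl }) (VecP.≡-dec _≟ᴳ_ xs ys)

  open import Data.List.Membership.DecPropositional _≟ᴬ_ using () renaming (_∈?_ to _∈ᴬ?_)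

  mapAtom-cong : ∀ {T U} {f g : T → U} (a : Atom T) → (∀ {t} → t ∈ᵥ args a → f t ≡ g t) →
    mapAtom f a ≡ mapAtom g a
  mapAtom-cong (atom p ts) f≗g = cong (atom p) (map-cong-∈ ts f≗g)

  mapAtom-id : ∀ {T} (a : Atom T) → mapAtom id a ≡ a
  mapAtom-id (atom p ts) = cong (atom p) (VecP.map-id ts)

  ⟦⟧-cong : ∀ {σ τ} (a : Atom Term) → (∀ {x} → Occurs x a → σ x ≡ τ x) → a ⟦ σ ⟧ ≡ a ⟦ τ ⟧
  ⟦⟧-cong a σ≗τ = mapAtom-cong a λ { {tvar x} x∈ → σ≗τ x∈ ; {tcon c} _ → refl }

  mapAtom-⟦⟧ : ∀ {f} → (∀ c → f (gcon c) ≡ gcon c) → ∀ σ (a : Atom Term) →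
    mapAtom f (a ⟦ σ ⟧) ≡ a ⟦ f ∘ σ ⟧
  mapAtom-⟦⟧ {f} f-con σ (atom p ts) =
    cong (atom p) (trans (sym (VecP.map-∘ f (inst σ) ts)) (VecP.map-cong inst-∘ ts))
    where
    inst-∘ : ∀ u → f (inst σ u) ≡ inst (f ∘ σ) u
    inst-∘ (tvar x) = refl
    inst-∘ (tcon c) = f-con c

  Holds-map : ∀ {I J f σ} → (∀ c → f (gcon c) ≡ gcon c) → (∀ a → I a → J (mapAtom f a)) →
    ∀ {Q} → Holds I σ Q → Holds J (f ∘ σ) Q
  Holds-map {J = J} {σ = σ} f-con f-hom = All.map λ {b} Ib → subst J (mapAtom-⟦⟧ f-con σ b) (f-hom _ Ib)

  Holds-occurs : ∀ {I σ x Q} → Holds I σ Q → Any (Occurs x) Q → Σ[ a ∈ Atom GTerm ] (I a × σ x ∈ᵥ args a)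
  Holds-occurs {σ = σ} (Ib ∷ _) (here x∈b) = _ , Ib , VMP.∈-map⁺ (inst σ) x∈b
  Holds-occurs (_ ∷ IQ) (there x∈Q) = Holds-occurs IQ x∈Q

  entailed-by-universal : ∀ {Rs D U σ Q} → IsUniversalModel Rs D U → Holds U σ Q → Entails Rs D Q
  entailed-by-universal {σ = σ} (_ , U→) UQ M M-model with f , f-con , f-hom ← U→ M M-model =
    f ∘ σ , Holds-map {J = M} f-con f-hom UQ

  varsOf : ∀ {n} → Vec Term n → List ℕ
  varsOf [] = []
  varsOf (tvar x ∷ ts) = x ∷ varsOf ts
  varsOf (tcon _ ∷ ts) = varsOf ts

  ∈-varsOf⁺ : ∀ {n x} (ts : Vec Term n) → tvar x ∈ᵥ ts → x ∈ varsOf ts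
  ∈-varsOf⁺ (tvar _ ∷ ts) (here refl) = here refl
  ∈-varsOf⁺ (tvar _ ∷ ts) (there x∈) = there (∈-varsOf⁺ ts x∈)
  ∈-varsOf⁺ (tcon _ ∷ ts) (there x∈) = ∈-varsOf⁺ ts x∈

  ∈-varsOf⁻ : ∀ {n x} (ts : Vec Term n) → x ∈ varsOf ts → tvar x ∈ᵥ ts
  ∈-varsOf⁻ (tvar _ ∷ ts) (here refl) = here refl
  ∈-varsOf⁻ (tvar _ ∷ ts) (there x∈) = there (∈-varsOf⁻ ts x∈)
  ∈-varsOf⁻ (tcon _ ∷ ts) x∈ = there (∈-varsOf⁻ ts x∈)

  vars : List (Atom Term) → List ℕ
  vars [] = []
  vars (b ∷ Q) = varsOf (args b) ++ vars Q

  ∈-vars⁺ : ∀ {x} Q → Any (Occurs x) Q → x ∈ vars Q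
  ∈-vars⁺ (b ∷ Q) (here x∈b) = ∈-++⁺ˡ (∈-varsOf⁺ (args b) x∈b)
  ∈-vars⁺ (b ∷ Q) (there x∈Q) = ∈-++⁺ʳ (varsOf (args b)) (∈-vars⁺ Q x∈Q)

  ∈-vars⁻ : ∀ {x} Q → x ∈ vars Q → Any (Occurs x) Q
  ∈-vars⁻ (b ∷ Q) x∈ with ∈-++⁻ (varsOf (args b)) x∈
  ... | inj₁ x∈b = here (∈-varsOf⁻ (args b) x∈b)
  ... | inj₂ x∈Q = there (∈-vars⁻ Q x∈Q)

  Holds-cong : ∀ {I σ τ} Q → (∀ {x} → x ∈ vars Q → σ x ≡ τ x) → Holds I σ Q → Holds I τ Q
  Holds-cong {I} Q σ≗τ IQ = All.tabulate λ {b} b∈Q →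
    subst I (⟦⟧-cong b λ x∈b → σ≗τ (∈-vars⁺ Q (lose b∈Q x∈b))) (All.lookup IQ b∈Q)

  terms : List (Atom GTerm) → List GTerm
  terms = concatMap (Vec.toList ∘ args)

  ∈-terms⁺ : ∀ {A a u} → a ∈ A → u ∈ᵥ args a → u ∈ terms A
  ∈-terms⁺ {a = a} a∈A u∈a = ∈-concat⁺′ (VMP.∈-toList⁺ u∈a) (∈-map⁺ (Vec.toList ∘ args) a∈A)

  update : Assignment → ℕ → GTerm → Assignment
  update σ x v y with y ≟ x
  ... | yes _ = v
  ... | no _ = σ y

  -- Off xs, the enumerated assignments take a junk value.
  assignments : List GTerm → List ℕ → List Assignment
  assignments ts [] = [ const (gcon 0) ]
  assignments ts (x ∷ xs) = cartesianProductWith (λ v σ → update σ x v) ts (assignments ts xs)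

  assignments-complete : ∀ ts xs (s : Assignment) → (∀ {x} → x ∈ xs → s x ∈ ts) →
    Σ[ σ ∈ Assignment ] (σ ∈ assignments ts xs × (∀ {x} → x ∈ xs → σ x ≡ s x))
  assignments-complete ts [] s _ = const (gcon 0) , here refl , λ ()
  assignments-complete ts (x ∷ xs) s s∈ts
    with σ , σ∈ , σ≗s ← assignments-complete ts xs s (s∈ts ∘ there) =
    update σ x (s x) , ∈-cartesianProductWith⁺ _ (s∈ts (here refl)) σ∈ , agree
    where
    agree : ∀ {y} → y ∈ x ∷ xs → update σ x (s x) y ≡ s y
    agree {y} y∈ with y ≟ x
    ... | yes refl = refl
    ... | no y≢x with y∈
    ...   | here y≡x = ⊥-elim (y≢x y≡x)
    ...   | there y∈xs = σ≗s y∈xs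

  module Chase (Rs : List Rule) (D : Database) where

    record Trigger : Set where
      constructor trigger
      field
        rl : Rule
        rl∈Rs : rl ∈ Rs
        match : Assignment
    open Trigger

    Active : List (Atom GTerm) → Trigger → Set
    Active A t = Holds (_∈ A) (match t) (body (rl t))

    active? : ∀ A t → Dec (Active A t)
    active? A t = All.all? (λ b → (b ⟦ match t ⟧) ∈ᴬ? A) (body (rl t))

    triggers : List (Atom GTerm) → List Trigger
    triggers A =
      concat (mapWith∈ Rs λ {r} r∈Rs → List.map (trigger r r∈Rs) (assignments (terms A) (vars (body r))))

    triggers-complete : ∀ {A r s} (r∈Rs : r ∈ Rs) → Holds (_∈ A) s (body r) →
      Σ[ σ ∈ Assignment ] (trigger r r∈Rs σ ∈ triggers A × (∀ {x} → x ∈ vars (body r) → σ x ≡ s x))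
    triggers-complete {A} {r} {s} r∈Rs s-body =
      let σ , σ∈ , σ≗s = assignments-complete (terms A) (vars (body r)) s s∈terms
      in σ , ∈-concat⁺′ (∈-map⁺ (trigger r r∈Rs) σ∈) (∈-mapWith∈⁺ _ r∈Rs) , σ≗s
      where
      s∈terms : ∀ {x} → x ∈ vars (body r) → s x ∈ terms A
      s∈terms x∈ with _ , a∈A , sx∈a ← Holds-occurs s-body (∈-vars⁻ (body r) x∈) = ∈-terms⁺ a∈A sx∈a

    -- The null for the existential variable x when trigger number j fires in round k records
    -- (k + 1, j, x), so that a homomorphism out of the chase can recover the trigger.
    fresh : ℕ → ℕ → ℕ → GTerm
    fresh k j x = gnull (pair (suc k) (pair j x))

    stageOf : GTerm → ℕ
    stageOf (gcon _) = 0
    stageOf (gnull n) = proj₁ (unpair n)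

    skolem : ℕ → ℕ → Trigger → Assignment
    skolem k j t x with x ∈ℕ? vars (body (rl t))
    ... | yes _ = match t x
    ... | no _ = fresh k j x

    skolem-frontier : ∀ k j t {x} → x ∈ vars (body (rl t)) → skolem k j t x ≡ match t x
    skolem-frontier k j t {x} x∈ with x ∈ℕ? vars (body (rl t))
    ... | yes _ = refl
    ... | no x∉ = ⊥-elim (x∉ x∈)

    fire : ∀ {P : Set} → ℕ → ℕ → Trigger → Dec P → List (Atom GTerm)
    fire k j t (yes _) = List.map (_⟦ skolem k j t ⟧) (head (rl t))
    fire k j t (no _) = []

    fired : List (Atom GTerm) → ℕ → ℕ → List (Atom GTerm)
    fired A k j with triggers A !? j
    ... | just t = fire k j t (active? A t)
    ... | nothing = []

    -- Every round fires all active triggers, including those fired in earlier rounds.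
    round : List (Atom GTerm) → ℕ → List (Atom GTerm)
    round A k = concat (applyUpTo (fired A k) (length (triggers A)))

    stage : ℕ → List (Atom GTerm)
    stage zero = List.map (mapAtom gcon) D
    stage (suc k) = stage k ++ round (stage k) k

    Chase : Interp
    Chase a = Σ[ k ∈ ℕ ] (a ∈ stage k)

    stage-mono : ∀ {k k′ a} → k ≤ k′ → a ∈ stage k → a ∈ stage k′
    stage-mono k≤k′ = go (≤⇒≤′ k≤k′)
      where
      go : ∀ {k k′ a} → k ≤′ k′ → a ∈ stage k → a ∈ stage k′
      go ≤′-refl a∈ = a∈
      go (≤′-step k≤′k′) a∈ = ∈-++⁺ˡ (go k≤′k′ a∈)

    Holds-stage : ∀ {σ} Q → Holds Chase σ Q → Σ[ k ∈ ℕ ] Holds (_∈ stage k) σ Q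
    Holds-stage [] [] = 0 , []
    Holds-stage (b ∷ Q) ((k , b∈) ∷ CQ) with k′ , Q∈ ← Holds-stage Q CQ =
      k ⊔ k′ , stage-mono (m≤m⊔n k k′) b∈ ∷ All.map (stage-mono (m≤n⊔m k k′)) Q∈

    fire⁻ : ∀ {P : Set} {k j t a} (d : Dec P) → a ∈ fire k j t d →
      P × Σ[ h ∈ Atom Term ] (h ∈ head (rl t) × a ≡ h ⟦ skolem k j t ⟧)
    fire⁻ (yes p) a∈ = p , ∈-map⁻ _ a∈

    fired⁻ : ∀ {A k j a} → a ∈ fired A k j →
      Σ[ t ∈ Trigger ] (triggers A !? j ≡ just t × Active A t ×
                        Σ[ h ∈ Atom Term ] (h ∈ head (rl t) × a ≡ h ⟦ skolem k j t ⟧))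
    fired⁻ {A} {k} {j} a∈ with triggers A !? j
    ... | just t = t , refl , fire⁻ (active? A t) a∈

    fired⁺ : ∀ {A k j t h} → triggers A !? j ≡ just t → Active A t → h ∈ head (rl t) →
      h ⟦ skolem k j t ⟧ ∈ fired A k j
    fired⁺ {A} {k} {j} {t} {h} eq act h∈ with triggers A !? j | eq
    ... | just .t | refl = fire⁺ (active? A t)
      where
      fire⁺ : (d : Dec (Active A t)) → h ⟦ skolem k j t ⟧ ∈ fire k j t d
      fire⁺ (yes _) = ∈-map⁺ (_⟦ skolem k j t ⟧) h∈
      fire⁺ (no inactive) = ⊥-elim (inactive act)

    stage-suc⁻ : ∀ {k a} → a ∈ stage (suc k) → a ∈ stage k ⊎ Σ[ j ∈ ℕ ] (a ∈ fired (stage k) k j)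
    stage-suc⁻ {k} a∈ with ∈-++⁻ (stage k) a∈
    ... | inj₁ a∈k = inj₁ a∈k
    ... | inj₂ a∈round
      with _ , a∈xs , xs∈ ← ∈-concat⁻′ (applyUpTo (fired (stage k) k) (length (triggers (stage k)))) a∈round
      with j , _ , refl ← ∈-applyUpTo⁻ (fired (stage k) k) xs∈ = inj₂ (j , a∈xs)

    fire-active : ∀ {k t} → t ∈ triggers (stage k) → Active (stage k) t →
      Σ[ j ∈ ℕ ] Holds (_∈ stage (suc k)) (skolem k j t) (head (rl t))
    fire-active {k} t∈ act with j , j< , eq ← ∈⇒!? t∈ =
      j , All.tabulate λ h∈ →
        ∈-++⁺ʳ (stage k) (∈-concat⁺′ (fired⁺ eq act h∈) (∈-applyUpTo⁺ (fired (stage k) k) j<))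

    chase-satisfies : ∀ r → r ∈ Rs → Satisfies Chase r
    chase-satisfies r r∈Rs s s-body =
      let k , s-body-k = Holds-stage (body r) s-body
          σ , t∈ , σ≗s = triggers-complete r∈Rs s-body-k
          j , heads = fire-active t∈ (Holds-cong {I = _∈ stage k} (body r) (λ x∈ → sym (σ≗s x∈)) s-body-k)
          t = trigger r r∈Rs σ
      in skolem k j t ,
         (λ x x∈ → trans (skolem-frontier k j t (∈-vars⁺ _ x∈)) (σ≗s (∈-vars⁺ _ x∈))) ,
         All.map (suc k ,_) heads

    chase-model : IsModel Rs D Chase
    chase-model = (λ d d∈ → 0 , ∈-map⁺ (mapAtom gcon) d∈) , chase-satisfies

    Born : ℕ → Atom GTerm → Set
    Born k a = ∀ {u} → u ∈ᵥ args a → stageOf u ≤ k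

    match-born : ∀ {A k t x} → (∀ {a} → a ∈ A → Born k a) → Active A t → x ∈ vars (body (rl t)) →
      stageOf (match t x) ≤ k
    match-born {A} {t = t} born act x∈ =
      let _ , a∈ , tx∈a = Holds-occurs {I = _∈ A} {σ = match t} act (∈-vars⁻ _ x∈) in born a∈ tx∈a

    skolem-born : ∀ {k j t} → (∀ {a} → a ∈ stage k → Born k a) → Active (stage k) t →
      ∀ x → stageOf (skolem k j t x) ≤ suc k
    skolem-born {k} {j} {t} born act x with x ∈ℕ? vars (body (rl t))
    ... | yes x∈ = m≤n⇒m≤1+n (match-born {t = t} born act x∈)
    ... | no _ = ≤-reflexive (cong proj₁ (unpair-pair (suc k) (pair j x)))

    stage-born : ∀ k {a} → a ∈ stage k → Born k a
    stage-born zero a∈ u∈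
      with _ , _ , refl ← ∈-map⁻ (mapAtom gcon) a∈
      with _ , _ , refl ← ∈-map⁻ᵥ u∈ = z≤n
    stage-born (suc k) a∈ u∈ with stage-suc⁻ a∈
    ... | inj₁ a∈k = m≤n⇒m≤1+n (stage-born k a∈k u∈)
    ... | inj₂ (j , a∈fired) with t , _ , act , h , _ , refl ← fired⁻ a∈fired with ∈-map⁻ᵥ u∈
    ...   | tcon _ , _ , refl = z≤n
    ...   | tvar x , _ , refl = skolem-born (stage-born k) act x

    module ToModel (M : Interp) (M-model : IsModel Rs D M) where

      record StageHom (k : ℕ) : Set where
        field
          hom : GTerm → GTerm
          hom-con : ∀ c → hom (gcon c) ≡ gcon c
          hom-stage : ∀ a → a ∈ stage k → M (mapAtom hom a)
      open StageHom

      module Step {k} (F : StageHom k) where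
        open StageHom F using () renaming (hom to f; hom-con to f-con; hom-stage to f-stage)

        extension : ∀ t → Active (stage k) t →
          Σ[ s′ ∈ Assignment ] ((∀ x → Any (Occurs x) (body (rl t)) → s′ x ≡ f (match t x)) ×
                                Holds M s′ (head (rl t)))
        extension t act =
          proj₂ M-model (rl t) (rl∈Rs t) (f ∘ match t) (Holds-map {I = _∈ stage k} {J = M} f-con f-stage act)

        -- The junk values here and in freshValue are never used: inactive triggers fire no atoms.
        witness : ∀ t → Dec (Active (stage k) t) → Assignment
        witness t (yes act) = proj₁ (extension t act)
        witness t (no _) = const (gcon 0)

        witness-frontier : ∀ {t x} (d : Dec (Active (stage k) t)) → Active (stage k) t → x ∈ vars (body (rl t)) →
          f (match t x) ≡ witness t d x
        witness-frontier {t} (yes act) _ x∈ = sym (proj₁ (proj₂ (extension t act)) _ (∈-vars⁻ _ x∈))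
        witness-frontier (no inactive) act _ = ⊥-elim (inactive act)

        witness-head : ∀ {t} (d : Dec (Active (stage k) t)) → Active (stage k) t → Holds M (witness t d) (head (rl t))
        witness-head {t} (yes act) _ = proj₂ (proj₂ (extension t act))
        witness-head (no inactive) act = ⊥-elim (inactive act)

        freshValue : ℕ → GTerm
        freshValue n with unpair n
        ... | j , x with triggers (stage k) !? j
        ...   | just t = witness t (active? (stage k) t) x
        ...   | nothing = gcon 0

        next : GTerm → GTerm
        next (gcon c) = gcon c
        next (gnull n) with proj₁ (unpair n) ≟ suc k
        ... | yes _ = freshValue (proj₂ (unpair n))
        ... | no _ = f (gnull n)

        next-old : ∀ u → stageOf u ≤ k → next u ≡ f u
        next-old (gcon c) _ = sym (f-con c)
        next-old (gnull n) n≤k with proj₁ (unpair n) ≟ suc k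
        ... | yes n≡1+k = ⊥-elim (1+n≰n (subst (_≤ k) n≡1+k n≤k))
        ... | no _ = refl

        next-fresh : ∀ {j t} → triggers (stage k) !? j ≡ just t →
          ∀ x → next (fresh k j x) ≡ witness t (active? (stage k) t) x
        next-fresh {j} eq x with proj₁ (unpair (pair (suc k) (pair j x))) ≟ suc k
        ... | no ne = ⊥-elim (ne (cong proj₁ (unpair-pair (suc k) (pair j x))))
        ... | yes _ rewrite unpair-pair (suc k) (pair j x) | unpair-pair j x | eq = refl

        next-skolem : ∀ {j t} → triggers (stage k) !? j ≡ just t → Active (stage k) t →
          ∀ x → next (skolem k j t x) ≡ witness t (active? (stage k) t) x
        next-skolem {j} {t} eq act x with x ∈ℕ? vars (body (rl t))
        ... | yes x∈ = trans (next-old _ (match-born {t = t} (stage-born k) act x∈))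
                             (witness-frontier (active? (stage k) t) act x∈)
        ... | no _ = next-fresh eq x

        next-stage : ∀ a → a ∈ stage (suc k) → M (mapAtom next a)
        next-stage a a∈ with stage-suc⁻ a∈
        ... | inj₁ a∈k = subst M (sym (mapAtom-cong a λ u∈ → next-old _ (stage-born k a∈k u∈))) (f-stage a a∈k)
        ... | inj₂ (j , a∈fired) with t , eq , act , h , h∈ , refl ← fired⁻ a∈fired =
          subst M (sym (trans (mapAtom-⟦⟧ (λ _ → refl) (skolem k j t) h)
                              (⟦⟧-cong h λ {x} _ → next-skolem eq act x)))
                  (All.lookup (witness-head (active? (stage k) t) act) h∈)

        next-stageHom : StageHom (suc k)
        next-stageHom = record { hom = next ; hom-con = λ _ → refl ; hom-stage = next-stage }

      database-stage : ∀ a → a ∈ stage zero → M (mapAtom id a)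
      database-stage a a∈ with d , d∈D , refl ← ∈-map⁻ (mapAtom gcon) a∈ =
        subst M (sym (mapAtom-id (mapAtom gcon d))) (proj₁ M-model d d∈D)

      stageHom : ∀ k → StageHom k
      stageHom zero = record { hom = id ; hom-con = λ _ → refl ; hom-stage = database-stage }
      stageHom (suc k) = Step.next-stageHom (stageHom k)

      limit : GTerm → GTerm
      limit u = hom (stageHom (stageOf u)) u

      stageHom-limit : ∀ k {u} → stageOf u ≤ k → hom (stageHom k) u ≡ limit u
      stageHom-limit zero {u} u≤0 = cong (λ m → hom (stageHom m) u) (sym (n≤0⇒n≡0 u≤0))
      stageHom-limit (suc k) {u} u≤1+k with stageOf u ≟ suc k
      ... | yes u≡1+k = cong (λ m → hom (stageHom m) u) (sym u≡1+k)
      ... | no u≢1+k = trans (Step.next-old (stageHom k) u u≤k) (stageHom-limit k u≤k)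
        where
        u≤k : stageOf u ≤ k
        u≤k = ≤-pred (≤∧≢⇒< u≤1+k u≢1+k)

      chase-hom : Hom Chase M
      chase-hom = limit , (λ _ → refl) , λ a (k , a∈) →
        subst M (mapAtom-cong a λ u∈ → stageHom-limit k (stage-born k a∈ u∈)) (hom-stage (stageHom k) a a∈)

    chase-universal : IsUniversalModel Rs D Chase
    chase-universal = chase-model , ToModel.chase-hom

proposition2 : (ar : ℕ → ℕ) → let open Sig ar in
    (Rs : List Rule) (D : Database) (q : NBCQ) →
    Entails Rs D (pos q) →
    (∀ a → a ∈ neg q → ¬ Entails Rs D (pos q ++ [ a ])) →
    Σ[ U ∈ Interp ] (IsUniversalModel Rs D U × U ⊨ q)
proposition2 ar Rs D q entails-pos not-entails-neg =
  Chase , chase-universal , σ , σ-pos , All.tabulate σ-neg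
  where
  open Sig ar
  open Chase {ar} Rs D

  σ : Assignment
  σ = proj₁ (entails-pos Chase chase-model)

  σ-pos : Holds Chase σ (pos q)
  σ-pos = proj₂ (entails-pos Chase chase-model)

  σ-neg : ∀ {a} → a ∈ neg q → ¬ Chase (a ⟦ σ ⟧)
  σ-neg {a} a∈ a-holds =
    not-entails-neg a a∈ (entailed-by-universal chase-universal (AllP.++⁺ σ-pos (a-holds ∷ [])))
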